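{- Let $D$ be a bicolored directed cycle with a chord which has a bikernel, and let $C$ be its base cycle. Then $C$ contains at most one monochromatic directed path on three vertices. Moreover, if such a path $P=(x,y,z)$ exists, then the chord of $D$ has $y$ as one of its endpoints.
   Context: A bicolored directed cycle with a chord is a digraph $D$ consisting of a directed cycle $C$ (the base cycle) together with one additional arc (the chord) joining two non-consecutive vertices of $C$, with every arc colored $1$ or $2$. A path is monochromatic if all its arcs have the same color. A non-empty $B\subseteq V(D)$ is a bikernel (by monochromatic paths) if: (i) for all distinct $u,v\in B$ there is no monochromatic directed $uv$-path; (ii) for every $v\in V(D)\setminus B$ there is a directed path of color $1$ from $v$ to a vertex of $B$; (iii) for every $v\in V(D)\setminus B$ there is a directed path of color $2$ from a vertex of $B$ to $v$. -}

module Defs where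

open import Data.Nat using (ℕ; zero; suc; _≤_)
open import Data.Nat.DivMod using (_%_; m%n<n)
open import Data.Fin using (Fin; toℕ; fromℕ<)
open import Data.Fin.Subset using (Subset; _∈_; _∉_)
open import Data.List using (List; []; _∷_)
open import Data.List.Relation.Unary.Unique.Propositional using (Unique)
open import Data.Product using (Σ; ∃; _×_; _,_)
open import Relation.Binary.PropositionalEquality using (_≡_; _≢_)
open import Relation.Nullary using (¬_)

data Colour : Set where
  c1 c2 : Colour

-- Successor on the base cycle 0 → 1 → … → n-1 → 0 (vertex set Fin n).
next : {n : ℕ} → Fin n → Fin n
next {zero} ()
next {suc m} i = fromℕ< (m%n<n (suc (toℕ i)) (suc m))

record BiColouredChordedCycle (n : ℕ) : Set where
  field
    atLeast3    : 3 ≤ n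
    chordTail   : Fin n
    chordHead   : Fin n
    distinct    : chordTail ≢ chordHead
    nonConsec₁  : next chordTail ≢ chordHead
    nonConsec₂  : next chordHead ≢ chordTail
    cycleColour : Fin n → Colour   -- colour of the cycle arc  i → next i
    chordColour : Colour

module _ {n : ℕ} (D : BiColouredChordedCycle n) where
  open BiColouredChordedCycle D

  data Arc : Set where
    cyc   : Fin n → Arc
    chord : Arc

  tail : Arc → Fin n
  tail (cyc i) = i
  tail chord   = chordTail

  head : Arc → Fin n
  head (cyc i) = next i
  head chord   = chordHead

  colour : Arc → Colour
  colour (cyc i) = cycleColour i
  colour chord   = chordColour

  data MonoWalk (c : Colour) : Fin n → Fin n → Set where
    []  : ∀ {u} → MonoWalk c u u
    _∷_ : ∀ {v} (a : Arc) → colour a ≡ c → MonoWalk c (head a) v →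
          MonoWalk c (tail a) v

  vertices : ∀ {c u v} → MonoWalk c u v → List (Fin n)
  vertices {u = u} []   = u ∷ []
  vertices {u = u} (_∷_ a _ w) = u ∷ vertices w

  MonoPath : Colour → Fin n → Fin n → Set
  MonoPath c u v = Σ (MonoWalk c u v) λ w → Unique (vertices w)

  record IsBikernel (B : Subset n) : Set where
    field
      nonEmpty    : ∃ λ v → v ∈ B
      independent : ∀ u v → u ∈ B → v ∈ B → u ≢ v →
                    ∀ c → ¬ MonoPath c u v
      absorbing   : ∀ v → v ∉ B → ∃ λ b → b ∈ B × MonoPath c1 v b
      dominating  : ∀ v → v ∉ B → ∃ λ b → b ∈ B × MonoPath c2 b v

  HasBikernel : Set
  HasBikernel = ∃ IsBikernel

  -- A monochromatic directed path on three vertices (x, y, z) in the base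
  -- cycle C: two consecutive cycle arcs  x → y = next x  and  y → z = next y
  -- of the same colour.  It is determined by x.
  MonoP3inC : Fin n → Set
  MonoP3inC x = cycleColour x ≡ cycleColour (next x)

-- A vertex of a bikernel B has its incoming cycle arc coloured 1 and its outgoing cycle arc
-- coloured 2.  Indeed, if u ∈ B and u → v has colour 1, then v ∉ B must receive an arc of
-- colour 2, which can only be the chord; so the colour-1 arc leaving v is the cycle arc v → w,
-- all arcs into w have colour 1, hence w ∈ B, and u → v → w is a monochromatic path inside B.
-- Dually for in-arcs.  Hence the centre y of a monochromatic path x → y → z on C lies outside B,
-- and since its two cycle arcs share a colour, the chord must supply its colour-2 in-arc or its
-- colour-1 out-arc: y is the head of a chord of colour 2 or the tail of a chord of colour 1.
-- Two distinct such centres would force both, since next is injective.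

module Submission where

open import Defs
open import Data.Nat using (ℕ; suc; _≤_; _<_; s≤s; z≤n)
open import Data.Nat.Properties using (suc-injective; m<1+n⇒m<n∨m≡n; 1+n≢n; m+1+n≢n; ≤-trans)
open import Data.Nat.DivMod using (_%_; m<n⇒m%n≡m; n%n≡0)
open import Data.Fin using (Fin; toℕ)
open import Data.Fin.Properties using (toℕ-fromℕ<; toℕ-injective; toℕ<n)
open import Data.Fin.Subset using (Subset; _∈_; _∉_)
open import Data.Fin.Subset.Properties using (_∈?_)
open import Data.List.Relation.Unary.All using ([]; _∷_)
open import Data.List.Relation.Unary.AllPairs using ([]; _∷_)
open import Data.Sum using (_⊎_; inj₁; inj₂)
open import Data.Product using (_×_; _,_; ∃)
open import Data.Empty using (⊥; ⊥-elim)
open import Relation.Nullary using (yes; no)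
open import Relation.Binary.PropositionalEquality

toℕ-next : ∀ {m} (i : Fin (suc m)) →
  (toℕ i < m × toℕ (next i) ≡ suc (toℕ i)) ⊎ (toℕ i ≡ m × toℕ (next i) ≡ 0)
toℕ-next {m} i with m<1+n⇒m<n∨m≡n (toℕ<n i)
... | inj₁ i<m = inj₁ (i<m , trans (toℕ-fromℕ< _) (m<n⇒m%n≡m (s≤s i<m)))
... | inj₂ i≡m = inj₂ (i≡m , trans (toℕ-fromℕ< _) (trans (cong (λ k → suc k % suc m) i≡m) (n%n≡0 (suc m))))

next-injective : ∀ {n} {i j : Fin n} → next i ≡ next j → i ≡ j
next-injective {suc m} {i} {j} eq with toℕ-next i | toℕ-next j | cong toℕ eq
... | inj₁ (_ , i′) | inj₁ (_ , j′) | e = toℕ-injective (suc-injective (trans (sym i′) (trans e j′)))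
... | inj₂ (i≡m , _) | inj₂ (j≡m , _) | _ = toℕ-injective (trans i≡m (sym j≡m))
... | inj₁ (_ , i′) | inj₂ (_ , j′) | e with () ← trans (sym i′) (trans e j′)
... | inj₂ (_ , i′) | inj₁ (_ , j′) | e with () ← trans (sym i′) (trans e j′)

next≢id : ∀ {n} → 2 ≤ n → (i : Fin n) → next i ≢ i
next≢id {suc m} (s≤s (s≤s _)) i eq with toℕ-next i
... | inj₁ (_ , i′) = 1+n≢n (trans (sym i′) (cong toℕ eq))
... | inj₂ (i≡m , i′) with () ← trans (sym i′) (trans (cong toℕ eq) i≡m)

next²≢id : ∀ {n} → 3 ≤ n → (i : Fin n) → next (next i) ≢ i
next²≢id {suc m} (s≤s (s≤s (s≤s _))) i eq with toℕ-next i | toℕ-next (next i) | cong toℕ eq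
... | inj₁ (_ , i′) | inj₁ (_ , i″) | e = m+1+n≢n 1 (trans (sym (trans i″ (cong suc i′))) e)
... | inj₁ (_ , i′) | inj₂ (i′≡m , i″) | e with () ← trans (sym i′≡m) (trans i′ (cong suc (trans (sym e) i″)))
... | inj₂ (i≡m , i′) | inj₁ (_ , i″) | e with () ← trans (sym i≡m) (trans (sym e) (trans i″ (cong suc i′)))
... | inj₂ (i≡m , i′) | inj₂ (i′≡m , _) | _ with () ← trans (sym i′≡m) i′

module _ {n : ℕ} (D : BiColouredChordedCycle n) where

  firstArc : ∀ {c u v} → MonoWalk D c u v →
             u ≡ v ⊎ ∃ λ a → tail D a ≡ u × colour D a ≡ c
  firstArc []            = inj₁ refl
  firstArc (_∷_ a a-c _) = inj₂ (a , refl , a-c)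

  lastArc : ∀ {c u v} → MonoWalk D c u v →
            u ≡ v ⊎ ∃ λ a → head D a ≡ v × colour D a ≡ c
  lastArc [] = inj₁ refl
  lastArc (_∷_ a a-c w) with lastArc w
  ... | inj₁ refl = inj₂ (a , refl , a-c)
  ... | inj₂ arc  = inj₂ arc

module Bikernel {n : ℕ} (D : BiColouredChordedCycle n) {B : Subset n} (K : IsBikernel D B) where
  open BiColouredChordedCycle D
  open IsBikernel K

  private
    clash : ∀ {c} → c ≡ c1 → c ≡ c2 → ⊥
    clash refl ()

    next≢ : ∀ i → i ≢ next i
    next≢ i = ≢-sym (next≢id (≤-trans (s≤s (s≤s z≤n)) atLeast3) i)

    next²≢ : ∀ i → i ≢ next (next i)
    next²≢ i = ≢-sym (next²≢id atLeast3 i)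

  ∈B⇒next∉B : ∀ u → u ∈ B → next u ∉ B
  ∈B⇒next∉B u u∈B v∈B =
    independent u (next u) u∈B v∈B (next≢ u) (cycleColour u)
      (_∷_ (cyc u) refl [] , (next≢ u ∷ []) ∷ [] ∷ [])

  ∈B⇒next²∉B : ∀ u → cycleColour u ≡ cycleColour (next u) → u ∈ B → next (next u) ∉ B
  ∈B⇒next²∉B u mono u∈B w∈B =
    independent u (next (next u)) u∈B w∈B (next²≢ u) (cycleColour u)
      ( _∷_ (cyc u) refl (_∷_ (cyc (next u)) (sym mono) [])
      , (next≢ u ∷ next²≢ u ∷ []) ∷ (next≢ (next u) ∷ []) ∷ [] ∷ [])

  c1-outArc : ∀ v → v ∉ B → cycleColour v ≡ c1 ⊎ (chordTail ≡ v × chordColour ≡ c1)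
  c1-outArc v v∉B with absorbing v v∉B
  ... | b , b∈B , (w , _) with firstArc D w
  ...   | inj₁ refl                 = ⊥-elim (v∉B b∈B)
  ...   | inj₂ (cyc _ , refl , a-c) = inj₁ a-c
  ...   | inj₂ (chord , T≡v , a-c)  = inj₂ (T≡v , a-c)

  c2-inArc : ∀ v → v ∉ B →
             (∃ λ w → next w ≡ v × cycleColour w ≡ c2) ⊎ (chordHead ≡ v × chordColour ≡ c2)
  c2-inArc v v∉B with dominating v v∉B
  ... | b , b∈B , (w , _) with lastArc D w
  ...   | inj₁ refl                 = ⊥-elim (v∉B b∈B)
  ...   | inj₂ (cyc u , u′≡v , a-c) = inj₁ (u , u′≡v , a-c)
  ...   | inj₂ (chord , H≡v , a-c)  = inj₂ (H≡v , a-c)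

  c2-inArc-next : ∀ u → next u ∉ B → cycleColour u ≡ c2 ⊎ (chordHead ≡ next u × chordColour ≡ c2)
  c2-inArc-next u v∉B with c2-inArc (next u) v∉B
  ... | inj₁ (w , w′≡u′ , w-c2) = inj₁ (subst (λ x → cycleColour x ≡ c2) (next-injective w′≡u′) w-c2)
  ... | inj₂ chordIn            = inj₂ chordIn

  ∈B-if-inArcs-c1 : ∀ u → cycleColour u ≡ c1 → (chordHead ≡ next u → chordColour ≡ c1) →
                    next u ∈ B
  ∈B-if-inArcs-c1 u u-c1 chord-c1 with next u ∈? B
  ... | yes v∈B = v∈B
  ... | no v∉B with c2-inArc-next u v∉B
  ...   | inj₁ u-c2             = ⊥-elim (clash u-c1 u-c2)
  ...   | inj₂ (H≡v , chord-c2) = ⊥-elim (clash (chord-c1 H≡v) chord-c2)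

  ∈B-if-outArcs-c2 : ∀ v → cycleColour v ≡ c2 → (chordTail ≡ v → chordColour ≡ c2) → v ∈ B
  ∈B-if-outArcs-c2 v v-c2 chord-c2 with v ∈? B
  ... | yes v∈B = v∈B
  ... | no v∉B with c1-outArc v v∉B
  ...   | inj₁ v-c1             = ⊥-elim (clash v-c1 v-c2)
  ...   | inj₂ (T≡v , chord-c1) = ⊥-elim (clash chord-c1 (chord-c2 T≡v))

  ∈B⇒outColour≡c2 : ∀ u → u ∈ B → cycleColour u ≡ c2
  ∈B⇒outColour≡c2 u u∈B with cycleColour u in u-c
  ... | c2 = refl
  ... | c1 with c2-inArc-next u v∉B | c1-outArc (next u) v∉B
    where v∉B = ∈B⇒next∉B u u∈B
  ...   | inj₁ u-c2       | _                = ⊥-elim (clash u-c u-c2)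
  ...   | inj₂ (H≡v , _)  | inj₂ (T≡v , _)   = ⊥-elim (distinct (trans T≡v (sym H≡v)))
  ...   | inj₂ (H≡v , _)  | inj₁ v-c1        =
    ⊥-elim (∈B⇒next²∉B u (trans u-c (sym v-c1)) u∈B
             (∈B-if-inArcs-c1 (next u) v-c1 λ H≡w → ⊥-elim (next≢ (next u) (trans (sym H≡v) H≡w))))

  next∈B⇒inColour≡c1 : ∀ w → next w ∈ B → cycleColour w ≡ c1
  next∈B⇒inColour≡c1 w v∈B with cycleColour w in w-c
  ... | c1 = refl
  ... | c2 with c1-outArc w w∉B | c2-inArc w w∉B
    where w∉B = λ w∈B → ∈B⇒next∉B w w∈B v∈B
  ...   | inj₁ w-c1       | _                       = ⊥-elim (clash w-c1 w-c)
  ...   | inj₂ (T≡w , _)  | inj₂ (H≡w , _)          = ⊥-elim (distinct (trans T≡w (sym H≡w)))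
  ...   | inj₂ (T≡w , _)  | inj₁ (u , refl , u-c2)  =
    ⊥-elim (∈B⇒next²∉B u (trans u-c2 (sym w-c))
             (∈B-if-outArcs-c2 u u-c2 λ T≡u → ⊥-elim (next≢ u (trans (sym T≡u) T≡w)))
             v∈B)

  monoP3-centre∉B : ∀ x → MonoP3inC D x → next x ∉ B
  monoP3-centre∉B x mono y∈B =
    clash (next∈B⇒inColour≡c1 x y∈B) (trans mono (∈B⇒outColour≡c2 (next x) y∈B))

  monoP3-centre-chordEnd : ∀ x → MonoP3inC D x →
                           (chordHead ≡ next x × chordColour ≡ c2)
                           ⊎ (chordTail ≡ next x × chordColour ≡ c1)
  monoP3-centre-chordEnd x mono with c2-inArc-next x y∉B | c1-outArc (next x) y∉B
    where y∉B = monoP3-centre∉B x mono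
  ... | inj₂ chordIn | _             = inj₁ chordIn
  ... | inj₁ _       | inj₂ chordOut = inj₂ chordOut
  ... | inj₁ x-c2    | inj₁ y-c1     = ⊥-elim (clash (trans mono y-c1) x-c2)

  monoP3-centre-on-chord : ∀ x → MonoP3inC D x → chordTail ≡ next x ⊎ chordHead ≡ next x
  monoP3-centre-on-chord x mono with monoP3-centre-chordEnd x mono
  ... | inj₁ (H≡y , _) = inj₂ H≡y
  ... | inj₂ (T≡y , _) = inj₁ T≡y

  monoP3-unique : ∀ x x′ → MonoP3inC D x → MonoP3inC D x′ → x ≡ x′
  monoP3-unique x x′ mono mono′ with monoP3-centre-chordEnd x mono | monoP3-centre-chordEnd x′ mono′
  ... | inj₁ (H≡y , _)     | inj₁ (H≡y′ , _)     = next-injective (trans (sym H≡y) H≡y′)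
  ... | inj₂ (T≡y , _)     | inj₂ (T≡y′ , _)     = next-injective (trans (sym T≡y) T≡y′)
  ... | inj₁ (_ , chord-c2) | inj₂ (_ , chord-c1) = ⊥-elim (clash chord-c1 chord-c2)
  ... | inj₂ (_ , chord-c1) | inj₁ (_ , chord-c2) = ⊥-elim (clash chord-c1 chord-c2)

mainTheorem17 : ∀ {n : ℕ} (D : BiColouredChordedCycle n) → HasBikernel D →
    (∀ (x x′ : Fin n) → MonoP3inC D x → MonoP3inC D x′ → x ≡ x′)
    × (∀ (x : Fin n) → MonoP3inC D x →
        BiColouredChordedCycle.chordTail D ≡ next x
        ⊎ BiColouredChordedCycle.chordHead D ≡ next x)
mainTheorem17 D (_ , K) = monoP3-unique , monoP3-centre-on-chord
  where open Bikernel D K
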